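{- Let $r$ be a positive integer and let $\lambda=(\lambda_1,\dots,\lambda_s)$ be an ordered partition of $r$. For every $r$-pattern $P\in\mathcal{P}(\lambda)$ let $m_P$ be a positive integer. Let $\mathcal{H}$ be a finite collection of pairwise disjoint subsets $e\subseteq\mathbb{Z}$, each of size $|e|=r$ (viewed as an ordered $r$-uniform hypergraph matching with the natural order of $\mathbb{Z}$), such that $\mathcal{H}$ is interval-wise $\lambda$-partite. Assume that for every $P\in\mathcal{P}(\lambda)$, every $P$-clique contained in $\mathcal{H}$ has size at most $m_P$. Then \[|\mathcal{H}|\le \prod_{P\in\mathcal{P}(\lambda)} m_P.\]
   Context: An $r$-pattern is a string in $\{\mathrm{A},\mathrm{B}\}^{2r}$ starting with $\mathrm{A}$ with exactly $r$ letters $\mathrm{A}$ and $r$ letters $\mathrm{B}$. Two distinct sets $e,f\in\mathcal{H}$ form the $r$-pattern obtained by listing the elements of $e\cup f$ in increasing order, writing $\mathrm{A}$ for elements of the set containing $\min(e\cup f)$ and $\mathrm{B}$ for elements of the other set. A $P$-clique is a subcollection any two distinct members of which form $P$; its size is its cardinality. A block partition of an $r$-pattern is a division into consecutive blocks each reading $\mathrm{A}^k\mathrm{B}^k$ or $\mathrm{B}^k\mathrm{A}^k$ ($k\ge1$); collectable patterns are those having one (it is unique). An ordered partition of $r$ is a sequence $(\lambda_1,\dots,\lambda_s)$ of positive integers summing to $r$. $\mathcal{P}(\lambda)$ is the set of collectable $r$-patterns whose block partition consists of $s$ blocks of lengths $2\lambda_1,\dots,2\lambda_s$ in this order. $\mathcal{H}$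 is $\lambda$-partite if there are $x_0<x_1<\dots<x_s$ in $\mathbb{R}\setminus\mathbb{Z}$ with $|e\cap(x_{i-1},x_i)|=\lambda_i$ for all $e\in\mathcal{H}$ and $i=1,\dots,s$; it is interval-wise $\lambda$-partite if such $x_0<\dots<x_s$ can be chosen so that additionally, for each $i=1,\dots,s$, the intervals $\operatorname{conv}(e\cap(x_{i-1},x_i))=[\min(e\cap(x_{i-1},x_i)),\max(e\cap(x_{i-1},x_i))]$, $e\in\mathcal{H}$, are pairwise disjoint. -}

module Defs where

open import Data.Bool using (Bool; true; false; _∧_; _∨_; not; if_then_else_; T)
open import Data.Nat using (ℕ; zero; suc; _*_; _≤_; _≡ᵇ_)
open import Data.Integer using (ℤ; _<_; _≤_; _<?_; _≤?_)
open import Data.List using (List; []; _∷_; _++_; length; replicate; take; drop; map; filterᵇ; zip)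
open import Data.List.Relation.Unary.All using (All)
open import Data.Nat.ListAction using (sum)
open import Data.List.Relation.Unary.Linked using (Linked)
open import Data.List.Membership.Propositional using (_∈_; _∉_)
open import Data.Fin using (Fin)
open import Data.Fin.Subset using (Subset; _∈_; ∣_∣)
open import Data.Product using (_×_; _,_; Σ; ∃)
open import Data.Sum using (_⊎_)
open import Relation.Nullary using (does; ¬_)
open import Relation.Binary.PropositionalEquality using (_≡_; _≢_)

data Letter : Set where
  A B : Letter

_==L_ : Letter → Letter → Bool
A ==L A = true
B ==L B = true
_ ==L _ = false

_==W_ : List Letter → List Letter → Bool
[] ==W [] = true
(x ∷ xs) ==W (y ∷ ys) = (x ==L y) ∧ (xs ==W ys)
_ ==W _ = false

countA : List Letter → ℕ
countA [] = 0
countA (A ∷ w) = suc (countA w)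
countA (B ∷ w) = countA w

startsWithA : List Letter → Bool
startsWithA (A ∷ _) = true
startsWithA _ = false

isPattern : ℕ → List Letter → Bool
isPattern r w = (length w ≡ᵇ (2 * r)) ∧ startsWithA w ∧ (countA w ≡ᵇ r)

isBlock : ℕ → List Letter → Bool
isBlock k w = (w ==W (replicate k A ++ replicate k B)) ∨ (w ==W (replicate k B ++ replicate k A))

hasBlocks : List ℕ → List Letter → Bool
hasBlocks [] w = w ==W []
hasBlocks (k ∷ ks) w = isBlock k (take (2 * k) w) ∧ hasBlocks ks (drop (2 * k) w)

inPλ : ℕ → List ℕ → List Letter → Bool
inPλ r lam w = isPattern r w ∧ hasBlocks lam w

words : ℕ → List (List Letter)
words zero = [] ∷ []
words (suc n) = map (A ∷_) (words n) ++ map (B ∷_) (words n)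

patternsOf : ℕ → List ℕ → List (List Letter)
patternsOf r lam = filterᵇ (inPλ r lam) (words (2 * r))

OrderedPartition : ℕ → List ℕ → Set
OrderedPartition r lam = All (λ k → 1 Data.Nat.≤ k) lam × sum lam ≡ r

-- Finite subsets of ℤ are represented by strictly increasing lists

IsSet : List ℤ → Set
IsSet = Linked _<_

Disjoint : List ℤ → List ℤ → Set
Disjoint e f = All (λ a → a ∉ f) e

mergeLab : List ℤ → List ℤ → List Letter
mergeLab [] ys = map (λ _ → B) ys
mergeLab (x ∷ xs) [] = map (λ _ → A) (x ∷ xs)
mergeLab (x ∷ xs) (y ∷ ys) =
  if does (x <? y) then A ∷ mergeLab xs (y ∷ ys) else B ∷ mergeLab (x ∷ xs) ys

swapL : Letter → Letter
swapL A = B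
swapL B = A

-- the pattern formed by e and f: A for the set containing min (e ∪ f)
forms : List ℤ → List ℤ → List Letter
forms e f with mergeLab e f
... | B ∷ w = map swapL (B ∷ w)
... | w = w

-- A non-integer real cut point x is encoded by the integer t = ⌊x⌋,
-- so that (x_{i-1}, x_i) ∩ ℤ = { z | t_{i-1} < z ≤ t_i }.

inSeg : ℤ → ℤ → ℤ → Bool
inSeg a b z = does (a <? z) ∧ does (z ≤? b)

piece : ℤ × ℤ → List ℤ → List ℤ
piece (a , b) e = filterᵇ (inSeg a b) e

segs : List ℤ → List (ℤ × ℤ)
segs (a ∷ b ∷ rest) = (a , b) ∷ segs (b ∷ rest)
segs _ = []

-- conv(xs) and conv(ys) disjoint (integer sets): one lies entirely below the other
ConvDisjoint : List ℤ → List ℤ → Set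
ConvDisjoint xs ys =
  All (λ a → All (λ c → a < c) ys) xs ⊎ All (λ c → All (λ a → c < a) xs) ys

IntervalWisePartite : ∀ {n} → List ℕ → (Fin n → List ℤ) → Set
IntervalWisePartite lam H =
  Σ (List ℤ) λ cuts →
    length cuts ≡ suc (length lam) × Linked Data.Integer._≤_ cuts ×
    All (λ { (k , seg) →
            (∀ i → length (piece seg (H i)) ≡ k) ×
            (∀ i j → i ≢ j → ConvDisjoint (piece seg (H i)) (piece seg (H j))) })
        (zip lam (segs cuts))

IsClique : ∀ {n} → (Fin n → List ℤ) → List Letter → Subset n → Set
IsClique H P S = ∀ i j → i Data.Fin.Subset.∈ S → j Data.Fin.Subset.∈ S → i ≢ j → forms (H i) (H j) ≡ P

{-# OPTIONS --safe #-}
module Submission where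

-- Write the pattern of two edges e, f as the A/B-merge of e and f, oriented so that it starts
-- with A. Interval-wise λ-partiteness makes this merge a concatenation of one block
-- AᵏBᵏ or BᵏAᵏ per segment, the letter recording which of the two pieces of the segment lies
-- lower. Lying lower is transitive, so for each P ∈ 𝒫(λ) "e precedes f in pattern P" is a
-- strict partial order, and any two distinct edges are comparable in the order of the pattern
-- they form. Chains of the order of P are P-cliques, hence have at most m_P elements, so the
-- height of an edge in that order (the length of the longest chain below it) is below m_P.
-- Comparable edges have different heights, hence the vector of heights is injective, and it
-- takes at most ∏ m_P values.

open import Defs
open import Data.Bool using (T)
open import Data.Bool.Properties using (T-∨; T-∧)
open import Data.Empty using (⊥-elim)
open import Data.Fin using (Fin; zero; combine; fromℕ<)
open import Data.Fin.Properties using (any?; combine-injective; fromℕ<-injective; injective⇒≤) renaming (_≟_ to _≟ᶠ_)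
open import Data.Fin.Subset using (Subset; ∣_∣; ⁅_⁆; _∪_; _∈_; _∉_)
open import Data.Fin.Subset.Properties using (x∈⁅x⁆; x∈⁅y⁆⇒x≡y; ∣⁅x⁆∣≡1; ∣p∣≤n; p⊆p∪q; q⊆p∪q; x∈p∪q⁻; p⊂q⇒∣p∣<∣q∣)
open import Data.Integer using (ℤ; _<?_; _≤?_) renaming (_<_ to _<ᶻ_; _≤_ to _≤ᶻ_)
import Data.Integer.Properties as ℤ
open import Data.List using (List; []; _∷_; _++_; length; replicate; map; filterᵇ; take; drop; zip)
open import Data.List.Properties using (map-++; map-∘; length-map; length-++; length-replicate; ++-identityʳ; ++-cancelˡ; ++-assoc; filter-complete; length-filter; ∷-injectiveˡ; ≡-dec)
open import Data.List.Membership.Propositional using () renaming (_∈_ to _∈ₗ_)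
open import Data.List.Membership.Propositional.Properties using (∈-map⁺; ∈-++⁺ˡ; ∈-++⁺ʳ; ∈-filter⁺; ∈-filter⁻)
open import Data.List.Relation.Unary.All as All using (All; []; _∷_)
open import Data.List.Relation.Unary.Any using (here; there)
open import Data.List.Relation.Unary.Linked using (Linked; [-]; _∷_; tail)
open import Data.List.Relation.Unary.Linked.Properties using (Linked⇒All)
open import Data.Nat using (ℕ; zero; suc; _+_; _*_; _≤_; _<_; z≤n; s≤s)
open import Data.Nat.ListAction using (sum; product)
import Data.Nat.Properties as ℕ
open import Data.Product using (∃-syntax; _×_; _,_; proj₁; proj₂)
open import Data.Sum using (_⊎_; inj₁; inj₂; [_,_]′)
open import Function using (_∘_; Equivalence)
open import Level using (0ℓ)
open import Relation.Binary using (Rel; Decidable; DecidableEquality; Transitive; Irreflexive)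
open import Relation.Binary.PropositionalEquality using (_≡_; _≢_; refl; sym; trans; cong; cong₂; subst; subst₂; module ≡-Reasoning)
open import Relation.Nullary using (Dec; ¬_; yes; no; does; contradiction)
open import Relation.Nullary.Decidable using (map′; _×-dec_; toSum; T?)
import Relation.Unary as U

greatest-≤ : {P : ℕ → Set} → U.Decidable P → P 0 → (N : ℕ) →
  ∃[ h ] P h × (∀ {k} → k ≤ N → P k → k ≤ h)
greatest-≤ P? p₀ zero = 0 , p₀ , λ { z≤n _ → z≤n }
greatest-≤ P? p₀ (suc N) with P? (suc N) | greatest-≤ P? p₀ N
... | yes p | _ = suc N , p , λ k≤N _ → k≤N
... | no ¬p | h , ph , greatest = h , ph , below
  where
  below : ∀ {k} → k ≤ suc N → _ → k ≤ h
  below k≤ pk with ℕ.m≤n⇒m<n∨m≡n k≤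
  ... | inj₁ k<sN = greatest (ℕ.≤-pred k<sN) pk
  ... | inj₂ refl = ⊥-elim (¬p pk)

module _ {C : Set} (m : C → ℕ) where

  encode : (L : List C) (h : C → ℕ) → All (λ c → h c < m c) L → Fin (product (map m L))
  encode []      h []       = zero
  encode (c ∷ L) h (p ∷ ps) = combine (fromℕ< p) (encode L h ps)

  encode-injective : ∀ L {h h′} (ps : All (λ c → h c < m c) L) (qs : All (λ c → h′ c < m c) L) →
    encode L h ps ≡ encode L h′ qs → All (λ c → h c ≡ h′ c) L
  encode-injective []      []       []       _  = []
  encode-injective (c ∷ L) (p ∷ ps) (q ∷ qs) eq =
    let eqᶜ , eqᴸ = combine-injective _ _ _ _ eq
    in fromℕ<-injective _ _ p q eqᶜ ∷ encode-injective L ps qs eqᴸ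

IsChain : ∀ {n} → Rel (Fin n) 0ℓ → Subset n → Set
IsChain R S = ∀ i j → i ∈ S → j ∈ S → i ≢ j → R i j ⊎ R j i

module _ {n} {R : Rel (Fin n) 0ℓ} where

  IsChain-⁅⁆ : ∀ x → IsChain R ⁅ x ⁆
  IsChain-⁅⁆ x i j i∈ j∈ i≢j = ⊥-elim (i≢j (trans (x∈⁅y⁆⇒x≡y x i∈) (sym (x∈⁅y⁆⇒x≡y x j∈))))

  IsChain-∪⁅⁆ : ∀ {S x} → IsChain R S → (∀ {z} → z ∈ S → R z x) → IsChain R (S ∪ ⁅ x ⁆)
  IsChain-∪⁅⁆ {S} {x} chain below i j i∈ j∈ i≢j with x∈p∪q⁻ S _ i∈ | x∈p∪q⁻ S _ j∈
  ... | inj₁ i∈S | inj₁ j∈S = chain i j i∈S j∈S i≢j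
  ... | inj₁ i∈S | inj₂ j∈x = inj₁ (subst (R i) (sym (x∈⁅y⁆⇒x≡y x j∈x)) (below i∈S))
  ... | inj₂ i∈x | inj₁ j∈S = inj₂ (subst (R j) (sym (x∈⁅y⁆⇒x≡y x i∈x)) (below j∈S))
  ... | inj₂ i∈x | inj₂ j∈x = IsChain-⁅⁆ x i j i∈x j∈x i≢j

module OrderCover {n : ℕ} {C : Set} (R : C → Rel (Fin n) 0ℓ)
  (R? : ∀ c → Decidable (R c)) (R-trans : ∀ c → Transitive (R c))
  (R-irrefl : ∀ c → Irreflexive _≡_ (R c)) where

  data Chain (c : C) : ℕ → Fin n → Set where
    start : ∀ {x} → Chain c 0 x
    step  : ∀ {k x y} → R c y x → Chain c k y → Chain c (suc k) x

  chain? : ∀ c k x → Dec (Chain c k x)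
  chain? c zero    x = yes start
  chain? c (suc k) x = map′ (λ (_ , r , ch) → step r ch) (λ { (step r ch) → _ , r , ch })
                            (any? λ y → R? c y x ×-dec chain? c k y)

  members : ∀ {c k x} → Chain c k x → Subset n
  members {x = x} start        = ⁅ x ⁆
  members {x = x} (step _ ch)  = members ch ∪ ⁅ x ⁆

  members-≤top : ∀ {c k x z} (ch : Chain c k x) → z ∈ members ch → z ≡ x ⊎ R c z x
  members-<top : ∀ {c k x y z} → R c y x → (ch : Chain c k y) → z ∈ members ch → R c z x

  members-≤top start z∈ = inj₁ (x∈⁅y⁆⇒x≡y _ z∈)
  members-≤top (step r ch) z∈ with x∈p∪q⁻ (members ch) _ z∈
  ... | inj₁ z∈ch  = inj₂ (members-<top r ch z∈ch)
  ... | inj₂ z∈⁅x⁆ = inj₁ (x∈⁅y⁆⇒x≡y _ z∈⁅x⁆)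

  members-<top {c} r ch z∈ with members-≤top ch z∈
  ... | inj₁ refl = r
  ... | inj₂ r′   = R-trans c r′ r

  ∣members∣ : ∀ {c k x} (ch : Chain c k x) → suc k ≤ ∣ members ch ∣
  ∣members∣ {x = x} start = subst (1 ≤_) (sym (∣⁅x⁆∣≡1 x)) ℕ.≤-refl
  ∣members∣ {c} {x = x} (step r ch) =
    ℕ.<-≤-trans (s≤s (∣members∣ ch))
      (p⊂q⇒∣p∣<∣q∣ (p⊆p∪q _ , x , q⊆p∪q (members ch) _ (x∈⁅x⁆ x) , x∉))
    where
    x∉ : x ∉ members ch
    x∉ x∈ = R-irrefl c refl (members-<top r ch x∈)

  members-chain : ∀ {c k x} (ch : Chain c k x) → IsChain (R c) (members ch)
  members-chain start       = IsChain-⁅⁆ _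
  members-chain (step r ch) = IsChain-∪⁅⁆ (members-chain ch) (members-<top r ch)

  chain-length<n : ∀ {c k x} → Chain c k x → k < n
  chain-length<n ch = ℕ.<-≤-trans (∣members∣ ch) (∣p∣≤n (members ch))

  height : C → Fin n → ℕ
  height c x = proj₁ (greatest-≤ (λ k → chain? c k x) start n)

  height-chain : ∀ c x → Chain c (height c x) x
  height-chain c x = proj₁ (proj₂ (greatest-≤ (λ k → chain? c k x) start n))

  height-greatest : ∀ {c k x} → Chain c k x → k ≤ height c x
  height-greatest {c} {x = x} ch =
    proj₂ (proj₂ (greatest-≤ (λ k → chain? c k x) start n)) (ℕ.<⇒≤ (chain-length<n ch)) ch

  height-mono : ∀ {c x y} → R c x y → height c x < height c y
  height-mono {c} {x} r = height-greatest (step r (height-chain c x))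

  height-≢ : ∀ {c x y} → R c x y ⊎ R c y x → height c x ≢ height c y
  height-≢ (inj₁ r) eq = ℕ.<-irrefl eq (height-mono r)
  height-≢ (inj₂ r) eq = ℕ.<-irrefl (sym eq) (height-mono r)

  module _ (L : List C) (m : C → ℕ)
    (comparable : ∀ x y → x ≢ y → ∃[ c ] c ∈ₗ L × (R c x y ⊎ R c y x))
    (chain-bound : ∀ {c} → c ∈ₗ L → (S : Subset n) → IsChain (R c) S → ∣ S ∣ ≤ m c) where

    height<bound : ∀ {c} → c ∈ₗ L → ∀ x → height c x < m c
    height<bound {c} c∈ x = ℕ.<-≤-trans (∣members∣ ch) (chain-bound c∈ _ (members-chain ch))
      where
      ch : Chain c (height c x) x
      ch = height-chain c x

    label : Fin n → Fin (product (map m L))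
    label x = encode m L (λ c → height c x) (All.tabulate λ c∈ → height<bound c∈ x)

    label-injective : ∀ {x y} → label x ≡ label y → x ≡ y
    label-injective {x} {y} eq with x ≟ᶠ y
    ... | yes x≡y = x≡y
    ... | no x≢y with comparable x y x≢y
    ...   | c , c∈ , r = ⊥-elim (height-≢ r (All.lookup (encode-injective m L _ _ eq) c∈))

    size≤product : n ≤ product (map m L)
    size≤product = injective⇒≤ label-injective

infix 4 _≺_

_≺_ : List ℤ → List ℤ → Set
xs ≺ ys = All (λ x → All (x <ᶻ_) ys) xs

map-const : ∀ {X : Set} {k} (l : Letter) (xs : List X) → length xs ≡ k → map (λ _ → l) xs ≡ replicate k l
map-const l []       refl = refl
map-const l (x ∷ xs) refl = cong (l ∷_) (map-const l xs refl)

length≡0⇒≡[] : ∀ {X : Set} (xs : List X) → length xs ≡ 0 → xs ≡ []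
length≡0⇒≡[] [] _ = refl

mergeLab-[]ʳ : ∀ xs → mergeLab xs [] ≡ map (λ _ → A) xs
mergeLab-[]ʳ []      = refl
mergeLab-[]ʳ (_ ∷ _) = refl

mergeLab-< : ∀ {x y} xs ys → x <ᶻ y → mergeLab (x ∷ xs) (y ∷ ys) ≡ A ∷ mergeLab xs (y ∷ ys)
mergeLab-< {x} {y} _ _ x<y with x <? y
... | yes _   = refl
... | no x≮y = contradiction x<y x≮y

mergeLab-≮ : ∀ {x y} xs ys → ¬ x <ᶻ y → mergeLab (x ∷ xs) (y ∷ ys) ≡ B ∷ mergeLab (x ∷ xs) ys
mergeLab-≮ {x} {y} _ _ x≮y with x <? y
... | yes x<y = contradiction x<y x≮y
... | no _    = refl

-- Case splits on x <? y go through toSum: a with-abstraction would hide the structural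
-- recursion on x ∷ xs from the termination checker.
mergeLab-++ : ∀ xs₁ xs₂ ys₁ ys₂ → xs₁ ≺ ys₂ → ys₁ ≺ xs₂ →
  mergeLab (xs₁ ++ xs₂) (ys₁ ++ ys₂) ≡ mergeLab xs₁ ys₁ ++ mergeLab xs₂ ys₂
mergeLab-++ []       _  []       _ _ _ = refl
mergeLab-++ []       [] (y ∷ ys₁) ys₂ _ _ = cong (B ∷_) (map-++ _ ys₁ ys₂)
mergeLab-++ []       (x ∷ xs₂) (y ∷ ys₁) ys₂ _ (y≺ ∷ ys₁≺) =
  trans (mergeLab-≮ xs₂ (ys₁ ++ ys₂) (ℤ.<-asym (All.head y≺)))
        (cong (B ∷_) (mergeLab-++ [] (x ∷ xs₂) ys₁ ys₂ [] ys₁≺))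
mergeLab-++ (x ∷ xs₁) xs₂ [] [] _ _ =
  cong (A ∷_) (trans (map-++ _ xs₁ xs₂) (cong (map _ xs₁ ++_) (sym (mergeLab-[]ʳ xs₂))))
mergeLab-++ (x ∷ xs₁) xs₂ [] (y ∷ ys₂) (x≺ ∷ xs₁≺) _ =
  trans (mergeLab-< (xs₁ ++ xs₂) ys₂ (All.head x≺))
        (cong (A ∷_) (trans (mergeLab-++ xs₁ xs₂ [] (y ∷ ys₂) xs₁≺ [])
                            (cong (_++ _) (mergeLab-[]ʳ xs₁))))
mergeLab-++ (x ∷ xs₁) xs₂ (y ∷ ys₁) ys₂ (x≺ ∷ xs₁≺) (y≺ ∷ ys₁≺) =
  [ (λ x<y → trans (mergeLab-< (xs₁ ++ xs₂) (ys₁ ++ ys₂) x<y)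
               (trans (cong (A ∷_) (mergeLab-++ xs₁ xs₂ (y ∷ ys₁) ys₂ xs₁≺ (y≺ ∷ ys₁≺)))
                      (cong (_++ _) (sym (mergeLab-< xs₁ ys₁ x<y)))))
  , (λ x≮y → trans (mergeLab-≮ (xs₁ ++ xs₂) (ys₁ ++ ys₂) x≮y)
               (trans (cong (B ∷_) (mergeLab-++ (x ∷ xs₁) xs₂ ys₁ ys₂ (x≺ ∷ xs₁≺) ys₁≺))
                      (cong (_++ _) (sym (mergeLab-≮ xs₁ ys₁ x≮y)))))
  ]′ (toSum (x <? y))

mergeLab-swap : ∀ xs ys → Disjoint xs ys → mergeLab ys xs ≡ map swapL (mergeLab xs ys)
mergeLab-swap []       ys _ = trans (mergeLab-[]ʳ ys) (map-∘ {g = swapL} ys)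
mergeLab-swap (x ∷ xs) [] _ = map-∘ {g = swapL} (x ∷ xs)
mergeLab-swap (x ∷ xs) (y ∷ ys) (x∉ ∷ xs∉) =
  [ (λ x<y → trans (mergeLab-≮ ys xs (ℤ.<-asym x<y))
               (trans (cong (B ∷_) (mergeLab-swap xs (y ∷ ys) xs∉))
                      (cong (map swapL) (sym (mergeLab-< xs ys x<y)))))
  , (λ x≮y → trans (mergeLab-< ys xs (ℤ.≤∧≢⇒< (ℤ.≮⇒≥ x≮y) (λ y≡x → x∉ (here (sym y≡x)))))
               (trans (cong (A ∷_) (mergeLab-swap (x ∷ xs) ys ((x∉ ∘ there) ∷ All.map (_∘ there) xs∉)))
                      (cong (map swapL) (sym (mergeLab-≮ xs ys x≮y)))))
  ]′ (toSum (x <? y))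

length-mergeLab : ∀ xs ys → length (mergeLab xs ys) ≡ length xs + length ys
length-mergeLab []       ys = length-map _ ys
length-mergeLab (x ∷ xs) [] = trans (length-map _ (x ∷ xs)) (sym (ℕ.+-identityʳ _))
length-mergeLab (x ∷ xs) (y ∷ ys) =
  [ (λ x<y → trans (cong length (mergeLab-< xs ys x<y)) (cong suc (length-mergeLab xs (y ∷ ys))))
  , (λ x≮y → trans (cong length (mergeLab-≮ xs ys x≮y))
               (trans (cong suc (length-mergeLab (x ∷ xs) ys)) (sym (ℕ.+-suc _ (length ys)))))
  ]′ (toSum (x <? y))

countA-mergeLab : ∀ xs ys → countA (mergeLab xs ys) ≡ length xs
countA-mergeLab []       ys = countA-Bs ys
  where
  countA-Bs : ∀ (ys : List ℤ) → countA (map (λ _ → B) ys) ≡ 0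
  countA-Bs []       = refl
  countA-Bs (_ ∷ ys) = countA-Bs ys
countA-mergeLab (x ∷ xs) [] = cong suc (countA-As xs)
  where
  countA-As : ∀ (xs : List ℤ) → countA (map (λ _ → A) xs) ≡ length xs
  countA-As []       = refl
  countA-As (_ ∷ xs) = cong suc (countA-As xs)
countA-mergeLab (x ∷ xs) (y ∷ ys) =
  [ (λ x<y → trans (cong countA (mergeLab-< xs ys x<y)) (cong suc (countA-mergeLab xs (y ∷ ys))))
  , (λ x≮y → trans (cong countA (mergeLab-≮ xs ys x≮y)) (countA-mergeLab (x ∷ xs) ys))
  ]′ (toSum (x <? y))

mergeLab-self : ∀ x xs → mergeLab (x ∷ xs) (x ∷ xs) ≡ B ∷ mergeLab (x ∷ xs) xs
mergeLab-self x xs = mergeLab-≮ xs xs (ℤ.<-irrefl refl)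

map-swapL-involutive : ∀ w → map swapL (map swapL w) ≡ w
map-swapL-involutive []      = refl
map-swapL-involutive (A ∷ w) = cong (A ∷_) (map-swapL-involutive w)
map-swapL-involutive (B ∷ w) = cong (B ∷_) (map-swapL-involutive w)

forms-≡ : ∀ {e f P} → mergeLab e f ≡ P → T (startsWithA P) → forms e f ≡ P
forms-≡ {P = A ∷ _} eq _ rewrite eq = refl

forms-≡-swap : ∀ {e f P} → Disjoint f e → mergeLab f e ≡ P → T (startsWithA P) → forms e f ≡ P
forms-≡-swap {e} {f} {A ∷ w} disj eq _
  rewrite mergeLab-swap f e disj | eq = cong (A ∷_) (map-swapL-involutive w)

block : Letter → ℕ → List Letter
block l k = replicate k l ++ replicate k (swapL l)

==W-refl : ∀ w → T (w ==W w)
==W-refl []      = _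
==W-refl (A ∷ w) = ==W-refl w
==W-refl (B ∷ w) = ==W-refl w

isBlock-block : ∀ l k → T (isBlock k (block l k))
isBlock-block A k = Equivalence.from T-∨ (inj₁ (==W-refl (block A k)))
isBlock-block B k = Equivalence.from T-∨ (inj₂ (==W-refl (block B k)))

length-block : ∀ l k → length (block l k) ≡ 2 * k
length-block l k = begin
  length (replicate k l ++ replicate k (swapL l)) ≡⟨ length-++ (replicate k l) ⟩
  length (replicate k l) + length (replicate k (swapL l))
    ≡⟨ cong₂ _+_ (length-replicate k) (length-replicate k) ⟩
  k + k                                           ≡⟨ cong (k +_) (sym (ℕ.+-identityʳ k)) ⟩
  2 * k                                           ∎
  where open ≡-Reasoning

_≺⟨_⟩_ : List ℤ → Letter → List ℤ → Set
xs ≺⟨ A ⟩ ys = xs ≺ ys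
xs ≺⟨ B ⟩ ys = ys ≺ xs

≺-trans : ∀ {xs ys zs} → ys ≢ [] → xs ≺ ys → ys ≺ zs → xs ≺ zs
≺-trans {ys = []}    ys≢[] _    _          = contradiction refl ys≢[]
≺-trans {ys = _ ∷ _} _     xs≺ (y≺ ∷ _) = All.map (λ x≺ → All.map (ℤ.<-trans (All.head x≺)) y≺) xs≺

≺⟨⟩-trans : ∀ l {xs ys zs} → ys ≢ [] → xs ≺⟨ l ⟩ ys → ys ≺⟨ l ⟩ zs → xs ≺⟨ l ⟩ zs
≺⟨⟩-trans A ys≢[] xs≺ys ys≺zs = ≺-trans ys≢[] xs≺ys ys≺zs
≺⟨⟩-trans B ys≢[] ys≺xs zs≺ys = ≺-trans ys≢[] zs≺ys ys≺xs

mergeLab-block : ∀ l {k xs ys} → length xs ≡ k → length ys ≡ k → xs ≺⟨ l ⟩ ys → mergeLab xs ys ≡ block l k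
mergeLab-block A {k} {xs} {ys} ∣xs∣ ∣ys∣ xs≺ys = begin
  mergeLab xs ys                          ≡⟨ cong (λ xs′ → mergeLab xs′ ys) (sym (++-identityʳ xs)) ⟩
  mergeLab (xs ++ []) ([] ++ ys)          ≡⟨ mergeLab-++ xs [] [] ys xs≺ys [] ⟩
  mergeLab xs [] ++ map (λ _ → B) ys      ≡⟨ cong (_++ _) (mergeLab-[]ʳ xs) ⟩
  map (λ _ → A) xs ++ map (λ _ → B) ys    ≡⟨ cong₂ _++_ (map-const A xs ∣xs∣) (map-const B ys ∣ys∣) ⟩
  block A k                               ∎
  where open ≡-Reasoning
mergeLab-block B {k} {xs} {ys} ∣xs∣ ∣ys∣ ys≺xs = begin
  mergeLab xs ys                          ≡⟨ cong (mergeLab xs) (sym (++-identityʳ ys)) ⟩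
  mergeLab ([] ++ xs) (ys ++ [])          ≡⟨ mergeLab-++ [] xs ys [] [] ys≺xs ⟩
  map (λ _ → B) ys ++ mergeLab xs []      ≡⟨ cong (map _ ys ++_) (mergeLab-[]ʳ xs) ⟩
  map (λ _ → B) ys ++ map (λ _ → A) xs    ≡⟨ cong₂ _++_ (map-const B ys ∣ys∣) (map-const A xs ∣xs∣) ⟩
  block B k                               ∎
  where open ≡-Reasoning

block-++-injective : ∀ l l′ k {X Y} → block l (suc k) ++ X ≡ block l′ (suc k) ++ Y → l ≡ l′ × X ≡ Y
block-++-injective l l′ k eq with ∷-injectiveˡ eq
... | refl = refl , ++-cancelˡ (block l (suc k)) _ _ eq

take-length-++ : ∀ {X : Set} (xs ys : List X) → take (length xs) (xs ++ ys) ≡ xs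
take-length-++ []       ys = refl
take-length-++ (x ∷ xs) ys = cong (x ∷_) (take-length-++ xs ys)

drop-length-++ : ∀ {X : Set} (xs ys : List X) → drop (length xs) (xs ++ ys) ≡ ys
drop-length-++ []       ys = refl
drop-length-++ (x ∷ xs) ys = drop-length-++ xs ys

hasBlocks-block-++ : ∀ l k {ks w} → T (hasBlocks ks w) → T (hasBlocks (k ∷ ks) (block l k ++ w))
hasBlocks-block-++ l k {w = w} blocks
  rewrite sym (length-block l k) | take-length-++ (block l k) w | drop-length-++ (block l k) w
  = Equivalence.from T-∧ (isBlock-block l k , blocks)

mergePieces : List (ℕ × (ℤ × ℤ)) → List ℤ → List ℤ → List Letter
mergePieces []               e f = []
mergePieces ((_ , seg) ∷ zs) e f = mergeLab (piece seg e) (piece seg f) ++ mergePieces zs e f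

totalPieceLength : List (ℕ × (ℤ × ℤ)) → List ℤ → ℕ
totalPieceLength zs e = sum (map (λ (_ , seg) → length (piece seg e)) zs)

module _ {n} (H : Fin n → List ℤ) where

  record GoodSegment (k : ℕ) (seg : ℤ × ℤ) : Set where
    field
      size     : ∀ i → length (piece seg (H i)) ≡ k
      disjoint : ∀ i j → i ≢ j → ConvDisjoint (piece seg (H i)) (piece seg (H j))

  GoodSegments : List (ℕ × (ℤ × ℤ)) → Set
  GoodSegments = All (λ (k , seg) → GoodSegment k seg)

  orientation : ∀ {k seg} → GoodSegment k seg → ∀ {i j} → i ≢ j →
    ∃[ l ] piece seg (H i) ≺⟨ l ⟩ piece seg (H j)
  orientation g i≢j with GoodSegment.disjoint g _ _ i≢j
  ... | inj₁ i≺j = A , i≺j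
  ... | inj₂ j≺i = B , j≺i

  segment-trans : ∀ {k seg} → GoodSegment k seg → ∀ {i j h X Y} → i ≢ j → j ≢ h →
    let p = λ a → piece seg (H a) in
    mergeLab (p i) (p j) ++ X ≡ mergeLab (p j) (p h) ++ Y →
    mergeLab (p i) (p h) ≡ mergeLab (p i) (p j) × X ≡ Y
  segment-trans {zero} {seg} g {i} {j} {h} {X} {Y} _ _ eq =
    trans (empty i h) (sym (empty i j)) ,
    trans (cong (_++ X) (sym (empty i j))) (trans eq (cong (_++ Y) (empty j h)))
    where
    open GoodSegment g
    empty : ∀ a b → mergeLab (piece seg (H a)) (piece seg (H b)) ≡ []
    empty a b = length≡0⇒≡[] (mergeLab (piece seg (H a)) (piece seg (H b)))
      (trans (length-mergeLab (piece seg (H a)) (piece seg (H b))) (cong₂ _+_ (size a) (size b)))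
  segment-trans {suc k} {seg} g {i} {j} {h} {X} {Y} i≢j j≢h eq
    with l , i≺j ← orientation g i≢j | l′ , j≺h ← orientation g j≢h
    with block-++-injective l l′ k
           (trans (cong (_++ X) (sym (mergeLab-block l (size i) (size j) i≺j)))
             (trans eq (cong (_++ Y) (mergeLab-block l′ (size j) (size h) j≺h))))
    where open GoodSegment g
  ... | refl , X≡Y =
    trans (mergeLab-block l (size i) (size h) (≺⟨⟩-trans l nonempty i≺j j≺h))
          (sym (mergeLab-block l (size i) (size j) i≺j)) ,
    X≡Y
    where
    open GoodSegment g
    nonempty : piece seg (H j) ≢ []
    nonempty p≡[] = ℕ.0≢1+n (trans (sym (cong length p≡[])) (size j))

  mergePieces-trans : ∀ {zs} → GoodSegments zs → ∀ {i j h} → i ≢ j → j ≢ h →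
    mergePieces zs (H i) (H j) ≡ mergePieces zs (H j) (H h) →
    mergePieces zs (H i) (H h) ≡ mergePieces zs (H i) (H j)
  mergePieces-trans []       _   _   _  = refl
  mergePieces-trans (g ∷ gs) i≢j j≢h eq with segment-trans g i≢j j≢h eq
  ... | first , rest = cong₂ _++_ first (mergePieces-trans gs i≢j j≢h rest)

  totalPieceLength-good : ∀ {zs} → GoodSegments zs → ∀ i → totalPieceLength zs (H i) ≡ sum (map proj₁ zs)
  totalPieceLength-good []       i = refl
  totalPieceLength-good (g ∷ gs) i = cong₂ _+_ (GoodSegment.size g i) (totalPieceLength-good gs i)

  hasBlocks-mergePieces : ∀ {zs} → GoodSegments zs → ∀ {i j} → i ≢ j →
    T (hasBlocks (map proj₁ zs) (mergePieces zs (H i) (H j)))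
  hasBlocks-mergePieces [] _ = _
  hasBlocks-mergePieces {(k , _) ∷ zs} (g ∷ gs) {i} {j} i≢j
    with l , i≺j ← orientation g i≢j =
    subst (λ w → T (hasBlocks (k ∷ map proj₁ zs) (w ++ mergePieces zs (H i) (H j))))
      (sym (mergeLab-block l (GoodSegment.size g i) (GoodSegment.size g j) i≺j))
      (hasBlocks-block-++ l k {map proj₁ zs} (hasBlocks-mergePieces gs i≢j))


above : ℤ → List ℤ → List ℤ
above a = filterᵇ (λ z → does (a <? z))

lastCut : ℤ → List ℤ → ℤ
lastCut a []       = a
lastCut _ (b ∷ bs) = lastCut b bs

IsSet⇒head< : ∀ {x xs} → IsSet (x ∷ xs) → All (x <ᶻ_) xs
IsSet⇒head< [-]           = []
IsSet⇒head< (x<y ∷ sorted) = Linked⇒All ℤ.<-trans x<y sorted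

above-all : ∀ {a} xs → All (a <ᶻ_) xs → above a xs ≡ xs
above-all     []       []           = refl
above-all {a} (x ∷ xs) (a<x ∷ a≺xs) with a <? x
... | yes _   = cong (x ∷_) (above-all xs a≺xs)
... | no a≮x = contradiction a<x a≮x

above-reject : ∀ {a x} xs → ¬ a <ᶻ x → above a (x ∷ xs) ≡ above a xs
above-reject {a} {x} _ a≮x with a <? x
... | yes a<x = contradiction a<x a≮x
... | no _    = refl

piece-none : ∀ {a b} xs → All (b <ᶻ_) xs → piece (a , b) xs ≡ []
piece-none         []       []           = refl
piece-none {a} {b} (x ∷ xs) (b<x ∷ b≺xs) with x ≤? b
... | yes x≤b = contradiction b<x (ℤ.≤⇒≯ x≤b)
... | no _ with a <? x
...   | yes _ = piece-none {a} xs b≺xs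
...   | no _  = piece-none {a} xs b≺xs

above-split : ∀ {a b} → a ≤ᶻ b → ∀ xs → IsSet xs → above a xs ≡ piece (a , b) xs ++ above b xs
above-split a≤b []       _      = refl
above-split {a} {b} a≤b (x ∷ xs) sorted with a <? x | x ≤? b
... | no a≮x | _ =
  trans (above-split a≤b xs (tail sorted))
        (cong (piece (a , b) xs ++_) (sym (above-reject xs (a≮x ∘ ℤ.≤-<-trans a≤b))))
... | yes _ | yes x≤b =
  cong (x ∷_) (trans (above-split a≤b xs (tail sorted))
                     (cong (piece (a , b) xs ++_) (sym (above-reject xs (ℤ.≤⇒≯ x≤b)))))
... | yes _ | no x≰b = begin
  x ∷ above a xs                     ≡⟨ cong (x ∷_) (above-all xs (All.map (ℤ.≤-<-trans a≤b) b≺xs)) ⟩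
  x ∷ xs                             ≡⟨ sym (above-all (x ∷ xs) (b<x ∷ b≺xs)) ⟩
  above b (x ∷ xs)                   ≡⟨ cong (_++ above b (x ∷ xs)) (sym (piece-none {a} xs b≺xs)) ⟩
  piece (a , b) xs ++ above b (x ∷ xs) ∎
  where
  open ≡-Reasoning
  b<x : b <ᶻ x
  b<x = ℤ.≰⇒> x≰b
  b≺xs : All (b <ᶻ_) xs
  b≺xs = All.map (ℤ.<-trans b<x) (IsSet⇒head< sorted)

piece-≤ : ∀ a b xs → All (_≤ᶻ b) (piece (a , b) xs)
piece-≤ a b []       = []
piece-≤ a b (x ∷ xs) with a <? x | x ≤? b
... | yes _ | yes x≤b = x≤b ∷ piece-≤ a b xs
... | yes _ | no _    = piece-≤ a b xs
... | no _  | _       = piece-≤ a b xs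

above-> : ∀ b xs → All (b <ᶻ_) (above b xs)
above-> b []       = []
above-> b (x ∷ xs) with b <? x
... | yes b<x = b<x ∷ above-> b xs
... | no _    = above-> b xs

piece≺above : ∀ a b xs ys → piece (a , b) xs ≺ above b ys
piece≺above a b xs ys = All.map (λ x≤b → All.map (ℤ.≤-<-trans x≤b) (above-> b ys)) (piece-≤ a b xs)

mergeLab-above : ∀ lam a rest → length rest ≡ length lam → Linked _≤ᶻ_ (a ∷ rest) →
  ∀ {e f} → IsSet e → IsSet f →
  mergeLab (above a e) (above a f) ≡
    mergePieces (zip lam (segs (a ∷ rest))) e f ++ mergeLab (above (lastCut a rest) e) (above (lastCut a rest) f)
mergeLab-above []        a []       _   _          _     _     = refl
mergeLab-above (k ∷ lam) a (b ∷ rest) |rest| (a≤b ∷ cuts) {e} {f} sorted-e sorted-f = begin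
  mergeLab (above a e) (above a f)
    ≡⟨ cong₂ mergeLab (above-split a≤b e sorted-e) (above-split a≤b f sorted-f) ⟩
  mergeLab (piece (a , b) e ++ above b e) (piece (a , b) f ++ above b f)
    ≡⟨ mergeLab-++ (piece (a , b) e) _ (piece (a , b) f) _ (piece≺above a b e f) (piece≺above a b f e) ⟩
  mergeLab (piece (a , b) e) (piece (a , b) f) ++ mergeLab (above b e) (above b f)
    ≡⟨ cong (mergeLab (piece (a , b) e) (piece (a , b) f) ++_) (mergeLab-above lam b rest (ℕ.suc-injective |rest|) cuts sorted-e sorted-f) ⟩
  mergeLab (piece (a , b) e) (piece (a , b) f) ++ (mergePieces (zip lam (segs (b ∷ rest))) e f ++ _)
    ≡⟨ sym (++-assoc (mergeLab (piece (a , b) e) (piece (a , b) f)) _ _) ⟩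
  _ ∎
  where open ≡-Reasoning

length-above : ∀ lam a rest → length rest ≡ length lam → Linked _≤ᶻ_ (a ∷ rest) → ∀ {e} → IsSet e →
  length (above a e) ≡ totalPieceLength (zip lam (segs (a ∷ rest))) e + length (above (lastCut a rest) e)
length-above []        a []         _      _            _ = refl
length-above (k ∷ lam) a (b ∷ rest) |rest| (a≤b ∷ cuts) {e} sorted = begin
  length (above a e)                                ≡⟨ cong length (above-split a≤b e sorted) ⟩
  length (piece (a , b) e ++ above b e)             ≡⟨ length-++ (piece (a , b) e) ⟩
  length (piece (a , b) e) + length (above b e)
    ≡⟨ cong (length (piece (a , b) e) +_) (length-above lam b rest (ℕ.suc-injective |rest|) cuts sorted) ⟩
  length (piece (a , b) e) + (totalPieceLength (zip lam (segs (b ∷ rest))) e + _)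
    ≡⟨ sym (ℕ.+-assoc (length (piece (a , b) e)) _ _) ⟩
  _ ∎
  where open ≡-Reasoning

-- The pieces already contain all of e, so nothing of e lies at or below the first cut or
-- above the last one.
pieces-exhaust : ∀ lam a rest → length rest ≡ length lam → Linked _≤ᶻ_ (a ∷ rest) → ∀ {e} → IsSet e →
  totalPieceLength (zip lam (segs (a ∷ rest))) e ≡ length e →
  above a e ≡ e × above (lastCut a rest) e ≡ []
pieces-exhaust lam a rest |rest| cuts {e} sorted total =
  filter-complete (T? ∘ λ z → does (a <? z)) all-above , length≡0⇒≡[] _ none-above-last
  where
  split : length (above a e) ≡ length e + length (above (lastCut a rest) e)
  split = trans (length-above lam a rest |rest| cuts sorted) (cong (_+ _) total)
  none-above-last : length (above (lastCut a rest) e) ≡ 0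
  none-above-last = ℕ.n≤0⇒n≡0 (ℕ.+-cancelˡ-≤ (length e) _ _
    (subst₂ _≤_ split (sym (ℕ.+-identityʳ (length e))) (length-filter (T? ∘ λ z → does (a <? z)) e)))
  all-above : length (above a e) ≡ length e
  all-above = trans split (trans (cong (length e +_) none-above-last) (ℕ.+-identityʳ (length e)))

mergeLab-≡-mergePieces : ∀ lam a rest → length rest ≡ length lam → Linked _≤ᶻ_ (a ∷ rest) →
  ∀ {e f} → IsSet e → IsSet f →
  totalPieceLength (zip lam (segs (a ∷ rest))) e ≡ length e →
  totalPieceLength (zip lam (segs (a ∷ rest))) f ≡ length f →
  mergeLab e f ≡ mergePieces (zip lam (segs (a ∷ rest))) e f
mergeLab-≡-mergePieces lam a rest |rest| cuts {e} {f} sorted-e sorted-f total-e total-f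
  with above-e , none-e ← pieces-exhaust lam a rest |rest| cuts sorted-e total-e
     | above-f , none-f ← pieces-exhaust lam a rest |rest| cuts sorted-f total-f = begin
  mergeLab e f                       ≡⟨ cong₂ mergeLab (sym above-e) (sym above-f) ⟩
  mergeLab (above a e) (above a f)   ≡⟨ mergeLab-above lam a rest |rest| cuts sorted-e sorted-f ⟩
  mergePieces zs e f ++ mergeLab (above (lastCut a rest) e) (above (lastCut a rest) f)
                                     ≡⟨ cong (λ w → mergePieces zs e f ++ w) (cong₂ mergeLab none-e none-f) ⟩
  mergePieces zs e f ++ []           ≡⟨ ++-identityʳ _ ⟩
  mergePieces zs e f                 ∎
  where
  open ≡-Reasoning
  zs : List (ℕ × (ℤ × ℤ))
  zs = zip lam (segs (a ∷ rest))

record Segmentation {n} (H : Fin n → List ℤ) (lam : List ℕ) : Set where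
  field
    segments  : List (ℕ × (ℤ × ℤ))
    good      : GoodSegments H segments
    blocks    : map proj₁ segments ≡ lam
    decompose : ∀ i j → mergeLab (H i) (H j) ≡ mergePieces segments (H i) (H j)

map-proj₁-zip : ∀ {X Y : Set} (xs : List X) (ys : List Y) → length ys ≡ length xs → map proj₁ (zip xs ys) ≡ xs
map-proj₁-zip []       []       _ = refl
map-proj₁-zip (x ∷ xs) (y ∷ ys) eq = cong (x ∷_) (map-proj₁-zip xs ys (ℕ.suc-injective eq))

length-segs : ∀ a rest → length (segs (a ∷ rest)) ≡ length rest
length-segs a []         = refl
length-segs a (b ∷ rest) = cong suc (length-segs b rest)

segmentation : ∀ {n lam} {H : Fin n → List ℤ} → IntervalWisePartite lam H →
  (∀ i → IsSet (H i)) → (∀ i → length (H i) ≡ sum lam) → Segmentation H lam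
segmentation {lam = lam} {H} (a ∷ rest , |cuts| , sorted , good) sets sizes = record
  { segments  = zs
  ; good      = good′
  ; blocks    = blocks
  ; decompose = λ i j → mergeLab-≡-mergePieces lam a rest |rest| sorted (sets i) (sets j) (total i) (total j)
  }
  where
  zs : List (ℕ × (ℤ × ℤ))
  zs = zip lam (segs (a ∷ rest))
  |rest| : length rest ≡ length lam
  |rest| = ℕ.suc-injective |cuts|
  good′ : GoodSegments H zs
  good′ = All.map (λ { {_ , _} (size , disjoint) → record { size = size ; disjoint = disjoint } }) good
  blocks : map proj₁ zs ≡ lam
  blocks = map-proj₁-zip lam (segs (a ∷ rest)) (trans (length-segs a rest) |rest|)
  total : ∀ i → totalPieceLength zs (H i) ≡ length (H i)
  total i = trans (totalPieceLength-good H good′ i) (trans (cong sum blocks) (sym (sizes i)))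

_≟ᴸ_ : DecidableEquality Letter
A ≟ᴸ A = yes refl
A ≟ᴸ B = no λ ()
B ≟ᴸ A = no λ ()
B ≟ᴸ B = yes refl

∈-words : ∀ w → w ∈ₗ words (length w)
∈-words []      = here refl
∈-words (A ∷ w) = ∈-++⁺ˡ (∈-map⁺ (A ∷_) (∈-words w))
∈-words (B ∷ w) = ∈-++⁺ʳ (map (A ∷_) (words (length w))) (∈-map⁺ (B ∷_) (∈-words w))

∈-patternsOf : ∀ {r lam w} → length w ≡ 2 * r → T (startsWithA w) → countA w ≡ r → T (hasBlocks lam w) →
  w ∈ₗ patternsOf r lam
∈-patternsOf {r} {lam} {w} |w| startsA #A blocks =
  ∈-filter⁺ (T? ∘ inPλ r lam) (subst (λ l → w ∈ₗ words l) |w| (∈-words w))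
    (Equivalence.from T-∧
      (Equivalence.from T-∧ (ℕ.≡⇒≡ᵇ _ _ |w| , Equivalence.from T-∧ (startsA , ℕ.≡⇒≡ᵇ _ _ #A)) , blocks))

∈-patternsOf⁻ : ∀ {r lam w} → w ∈ₗ patternsOf r lam → T (inPλ r lam w)
∈-patternsOf⁻ {r} {lam} w∈ = proj₂ (∈-filter⁻ (T? ∘ inPλ r lam) {xs = words (2 * r)} w∈)

module PatternOrder {n} (H : Fin n → List ℤ) {r lam} (1≤r : 1 ≤ r)
  (sizes : ∀ i → length (H i) ≡ r) (disjoint : ∀ i j → i ≢ j → Disjoint (H i) (H j))
  (S : Segmentation H lam) where

  open Segmentation S

  -- The A-letters of mergeLab (H i) (H j) come from H i, so P starting with A means that
  -- H i contains min (H i ∪ H j).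
  Precedes : List Letter → Rel (Fin n) 0ℓ
  Precedes P i j = mergeLab (H i) (H j) ≡ P × T (startsWithA P)

  precedes? : ∀ P → Decidable (Precedes P)
  precedes? P i j = ≡-dec _≟ᴸ_ (mergeLab (H i) (H j)) P ×-dec T? (startsWithA P)

  precedes-irrefl : ∀ P → Irreflexive _≡_ (Precedes P)
  precedes-irrefl P {i} refl (merge≡P , startsA) with H i | sizes i
  ... | []     | |Hi| = contradiction (subst (1 ≤_) (sym |Hi|) 1≤r) λ ()
  ... | x ∷ xs | _    = subst (T ∘ startsWithA) (trans (sym merge≡P) (mergeLab-self x xs)) startsA

  precedes-trans : ∀ P → Transitive (Precedes P)
  precedes-trans P {i} {j} {h} i⊏j@(ij≡P , startsA) j⊏h@(jh≡P , _) = ih≡P , startsA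
    where
    i≢j : i ≢ j
    i≢j i≡j = precedes-irrefl P i≡j i⊏j
    j≢h : j ≢ h
    j≢h j≡h = precedes-irrefl P j≡h j⊏h
    open ≡-Reasoning
    ih≡P : mergeLab (H i) (H h) ≡ P
    ih≡P = begin
      mergeLab (H i) (H h)                ≡⟨ decompose i h ⟩
      mergePieces segments (H i) (H h)
        ≡⟨ mergePieces-trans H good i≢j j≢h
             (trans (sym (decompose i j)) (trans ij≡P (trans (sym jh≡P) (decompose j h)))) ⟩
      mergePieces segments (H i) (H j)    ≡⟨ sym (decompose i j) ⟩
      mergeLab (H i) (H j)                ≡⟨ ij≡P ⟩
      P                                   ∎

  length-mergeLab-H : ∀ i j → length (mergeLab (H i) (H j)) ≡ 2 * r
  length-mergeLab-H i j =
    trans (length-mergeLab (H i) (H j)) (trans (cong₂ _+_ (sizes i) (sizes j)) (cong (r +_) (sym (ℕ.+-identityʳ r))))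

  mergeLab-∈-patternsOf : ∀ {i j} → i ≢ j → T (startsWithA (mergeLab (H i) (H j))) →
    mergeLab (H i) (H j) ∈ₗ patternsOf r lam
  mergeLab-∈-patternsOf {i} {j} i≢j startsA =
    ∈-patternsOf {lam = lam} (length-mergeLab-H i j) startsA (trans (countA-mergeLab (H i) (H j)) (sizes i))
      (subst₂ (λ ks w → T (hasBlocks ks w)) blocks (sym (decompose i j)) (hasBlocks-mergePieces H good i≢j))

  startsWithA-either : ∀ {i j} → i ≢ j →
    T (startsWithA (mergeLab (H i) (H j))) ⊎ T (startsWithA (mergeLab (H j) (H i)))
  startsWithA-either {i} {j} i≢j with mergeLab (H i) (H j) in eq
  ... | A ∷ _ = inj₁ _
  ... | B ∷ _ = inj₂ (subst (T ∘ startsWithA)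
                  (sym (trans (mergeLab-swap (H i) (H j) (disjoint i j i≢j)) (cong (map swapL) eq))) _)
  ... | []    = contradiction (subst (1 ≤_) (trans (sym (length-mergeLab-H i j)) (cong length eq))
                                  (ℕ.≤-trans 1≤r (ℕ.m≤m+n r _))) λ ()

  comparable : ∀ i j → i ≢ j → ∃[ P ] P ∈ₗ patternsOf r lam × (Precedes P i j ⊎ Precedes P j i)
  comparable i j i≢j with startsWithA-either i≢j
  ... | inj₁ startsA = _ , mergeLab-∈-patternsOf i≢j startsA , inj₁ (refl , startsA)
  ... | inj₂ startsA = _ , mergeLab-∈-patternsOf (i≢j ∘ sym) startsA , inj₂ (refl , startsA)

  chain⇒clique : ∀ {P} S → IsChain (Precedes P) S → IsClique H P S
  chain⇒clique S chain i j i∈ j∈ i≢j with chain i j i∈ j∈ i≢j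
  ... | inj₁ (ij≡P , startsA) = forms-≡ {H i} {H j} ij≡P startsA
  ... | inj₂ (ji≡P , startsA) = forms-≡-swap (disjoint j i (i≢j ∘ sym)) ji≡P startsA

  size≤product : (m : List Letter → ℕ) →
    (∀ P → T (inPλ r lam P) → (S : Subset n) → IsClique H P S → ∣ S ∣ ≤ m P) →
    n ≤ product (map m (patternsOf r lam))
  size≤product m clique-bound =
    OrderCover.size≤product Precedes precedes? precedes-trans precedes-irrefl (patternsOf r lam) m comparable
      (λ P∈ S chain → clique-bound _ (∈-patternsOf⁻ {r} {lam} P∈) S (chain⇒clique S chain))

lemma3p2 : (r : ℕ) → 1 ≤ r →
    (lam : List ℕ) → OrderedPartition r lam →
    (m : List Letter → ℕ) → (∀ P → T (inPλ r lam P) → 1 ≤ m P) →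
    (n : ℕ) (H : Fin n → List ℤ) →
    (∀ i → IsSet (H i)) → (∀ i → length (H i) ≡ r) →
    (∀ i j → i ≢ j → Disjoint (H i) (H j)) →
    IntervalWisePartite lam H →
    (∀ P → T (inPλ r lam P) → (S : Subset n) → IsClique H P S → ∣ S ∣ ≤ m P) →
    n ≤ product (map m (patternsOf r lam))
lemma3p2 r 1≤r lam (_ , Σλ≡r) m _ n H sets sizes disjoint partite clique-bound =
  PatternOrder.size≤product H 1≤r sizes disjoint (segmentation partite sets sizes′) m clique-bound
  where
  sizes′ : ∀ i → length (H i) ≡ sum lam
  sizes′ i = trans (sizes i) (sym Σλ≡r)
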